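{- Let $\mathbf{c}=(\mathbf{p},I)$ be a coloring problem on a finite set $N$, and let $x,y$ be indeterminates. Then \[\chi(\mathbf{c},x+y)=\sum_{S\in\mathbf{p}}\chi(\mathbf{c}|_S,x)\,\chi(\mathbf{c}/S,y).\]
   Context: A coloring problem on a finite set $N$ is a pair $(\mathbf{p},I)$ where $\mathbf{p}$ is a family of subsets of $N$ with $\emptyset,N\in\mathbf{p}$, partially ordered by inclusion; writing $\mathrm{Int}(\mathbf{p})$ for the set of intervals $[S,T]$ ($S\subseteq T$, $S,T\in\mathbf{p}$) ordered by inclusion, $I$ is an order ideal of $\mathrm{Int}(\mathbf{p})$ containing $[S,S]$ for every $S\in\mathbf{p}$. A proper coloring of $(\mathbf{p},I)$ is a function $f:N\to\mathbb{Z}_{>0}$ such that for every integer $n\ge0$, $[f^{ -1}([n]),f^{ -1}([n+1])]\in I$, where $[n]=\{1,\dots,n\}$, $[0]=\emptyset$. The chromatic polynomial $\chi(\mathbf{p},I,n)$ is the number of proper colorings with values in $\{1,\dots,n\}$; it is a polynomial in $n$. For $S\in\mathbf{p}$, the restriction is the coloring problem $\mathbf{c}|_S=(\mathbf{p}|_S,I|_S)$ on $S$ with $\mathbf{p}|_S=\{T\in\mathbf{p}:T\subseteq S\}$ and $I|_S=\{[X,Y]\in I: Y\subseteq S\}$; the contraction is the coloring problem $\mathbf{c}/S=(\mathbf{p}/S,I/S)$ on $N\setminus S$ with $\mathbf{p}/S=\{X\subseteq N\setminus S: X\cup S\in\mathbf{p}\}$ and $I/S=\{[X,Y]: X\subseteq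 Y\subseteq N\setminus S,\ [X\cup S,Y\cup S]\in I\}$. -}

module Defs where

open import Data.Nat using (ℕ; zero; suc; _+_; _*_; _<ᵇ_)
open import Data.Bool using (Bool; true; false; _∧_; if_then_else_; not)
open import Data.Fin using (Fin; toℕ)
open import Data.Fin.Subset using (Subset; _⊆_; _∪_; _─_; ⊥; ⊤)
open import Data.Fin.Subset.Properties using (_⊆?_)
open import Data.Vec using (Vec; []; _∷_; tabulate; lookup; toList)
open import Data.List using (List; []; _∷_; map; concatMap; allFin; upTo)
open import Data.Nat.ListAction using (sum)
open import Data.Maybe using (Maybe; just; nothing; is-just)
open import Data.Product using (_×_)
open import Relation.Binary.PropositionalEquality using (_≡_)
open import Relation.Nullary.Decidable using (⌊_⌋)

-- A (raw) coloring problem whose ground set N is a subset of Fin k.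
record Problem (k : ℕ) : Set where
  field
    ground : Subset k
    inP    : Subset k → Bool
    inI    : Subset k → Subset k → Bool
open Problem public

record IsColoringProblem {k : ℕ} (c : Problem k) : Set where
  field
    p-sub     : ∀ T → inP c T ≡ true → T ⊆ ground c
    p-empty   : inP c ⊥ ≡ true
    p-ground  : inP c (ground c) ≡ true
    I-interval : ∀ S T → inI c S T ≡ true → (inP c S ≡ true) × (inP c T ≡ true) × (S ⊆ T)
    -- I is an order ideal of Int(p): [S',T'] ⊆ [S,T] as intervals means S ⊆ S' ⊆ T' ⊆ T
    I-ideal   : ∀ S T S' T' → inI c S T ≡ true → inP c S' ≡ true → inP c T' ≡ true →
                S ⊆ S' → S' ⊆ T' → T' ⊆ T → inI c S' T' ≡ true
    I-diag    : ∀ S → inP c S ≡ true → inI c S S ≡ true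

allB : {A : Set} → (A → Bool) → List A → Bool
allB P []       = true
allB P (x ∷ xs) = P x ∧ allB P xs

_==_ : Bool → Bool → Bool
true  == b = b
false == b = not b

_⊆ᵇ_ : {k : ℕ} → Subset k → Subset k → Bool
X ⊆ᵇ Y = ⌊ X ⊆? Y ⌋

restrict : {k : ℕ} → Problem k → Subset k → Problem k
restrict c S = record
  { ground = S
  ; inP    = λ T → inP c T ∧ (T ⊆ᵇ S)
  ; inI    = λ X Y → inI c X Y ∧ (Y ⊆ᵇ S)
  }

contract : {k : ℕ} → Problem k → Subset k → Problem k
contract c S = record
  { ground = ground c ─ S
  ; inP    = λ X → (X ⊆ᵇ (ground c ─ S)) ∧ inP c (X ∪ S)
  ; inI    = λ X Y → (X ⊆ᵇ Y) ∧ ((Y ⊆ᵇ (ground c ─ S)) ∧ inI c (X ∪ S) (Y ∪ S))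
  }

allSubsets : (k : ℕ) → List (Subset k)
allSubsets zero    = [] ∷ []
allSubsets (suc k) = concatMap (λ s → (false ∷ s) ∷ (true ∷ s) ∷ []) (allSubsets k)

allVecs : {A : Set} → List A → (k : ℕ) → List (Vec A k)
allVecs xs zero    = [] ∷ []
allVecs xs (suc k) = concatMap (λ v → map (λ a → a ∷ v) xs) (allVecs xs k)

-- Colorings with colors {1,…,n} (color c ∈ Fin n stands for toℕ c + 1) of a ground
-- set N ⊆ Fin k: vectors f with f i = nothing exactly outside N.
allMaybeFin : (n : ℕ) → List (Maybe (Fin n))
allMaybeFin n = nothing ∷ map just (allFin n)

validOn : {k n : ℕ} → Subset k → Vec (Maybe (Fin n)) k → Bool
validOn N f = allB (λ i → is-just (lookup f i) == lookup N i) (allFin _)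

below : {n : ℕ} → ℕ → Maybe (Fin n) → Bool
below m nothing  = false
below m (just c) = toℕ c <ᵇ m

preimage : {k n : ℕ} → Vec (Maybe (Fin n)) k → ℕ → Subset k
preimage f m = tabulate λ i → below m (lookup f i)

-- Properness: [f⁻¹([m]), f⁻¹([m+1])] ∈ I for all m ≥ 0.  For an n-coloring and
-- m ≥ n both preimages equal N, so it suffices to check m = 0,…,n.
proper : {k n : ℕ} → Problem k → Vec (Maybe (Fin n)) k → Bool
proper {n = n} c f = allB (λ m → inI c (preimage f m) (preimage f (suc m))) (upTo (suc n))

count : {A : Set} → (A → Bool) → List A → ℕ
count P []       = 0
count P (x ∷ xs) = if P x then suc (count P xs) else count P xs

chromatic : {k : ℕ} → Problem k → ℕ → ℕ
chromatic {k} c n =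
  count (λ f → validOn (ground c) f ∧ proper c f) (allVecs (allMaybeFin n) k)

sumOverP : {k : ℕ} → Problem k → (Subset k → ℕ) → ℕ
sumOverP {k} c g = sum (map (λ S → if inP c S then g S else 0) (allSubsets k))

-- A proper (x + y)-coloring f cuts N at S = f⁻¹([x]): the colors ≤ x give a coloring u
-- of S, the colors > x (shifted down by x) a coloring v of N ∖ S. The levels of f are the
-- levels of u followed by the levels of v with S added, so f is proper for c exactly when
-- S ∈ p, u is proper for c|_S and v is proper for c/S ([S,S] ∈ I links the two halves).
-- Conversely every such triple (S, u, v) glues back to a unique f, and counting gives the
-- identity.
module Submission where

open import Defs
open import Algebra.Bundles using (CommutativeMonoid)
open import Data.Bool using (Bool; true; false; _∧_; _∨_; not; if_then_else_)
open import Data.Bool.Properties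
  using (∧-assoc; ∧-identityʳ; ∧-zeroʳ; ∨-identityʳ; ∨-zeroʳ; ⇔→≡; T-≡; ∧-commutativeMonoid)
open import Data.Empty using (⊥-elim)
open import Data.Fin using (Fin; zero; suc; toℕ; _↑ˡ_; _↑ʳ_)
open import Data.Fin.Properties using (toℕ-↑ˡ; toℕ-↑ʳ; toℕ<n)
open import Data.Fin.Subset using (Subset; _∪_; _─_; ⊥; ⊤)
open import Data.Fin.Subset.Properties using (_⊆?_; ∪-identityˡ)
open import Data.List using (List; []; _∷_; [_]; _++_; map; concatMap; allFin; upTo; applyUpTo)
open import Data.List.Membership.Propositional using (_∈_)
open import Data.List.Membership.Propositional.Properties using (∈-allFin; ∈-upTo⁻)
open import Data.List.Properties using (map-cong; map-∘; map-++; map-tabulate; upTo-∷ʳ; map-upTo)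
open import Data.List.Relation.Unary.Any using (here; there)
open import Data.Maybe using (Maybe; just; nothing; is-just)
open import Data.Nat using (ℕ; zero; suc; _+_; _*_; _<ᵇ_; _≤_; _<_; z≤n; s≤s)
open import Data.Nat.ListAction using (sum)
open import Data.Nat.ListAction.Properties using (sum-++)
open import Data.Nat.Properties
  using ( +-assoc; +-comm; +-identityʳ; +-suc; *-zeroʳ; *-distribˡ-+; *-distribʳ-+
        ; ≤-refl; ≤-trans; <⇒≤; n≤1+n; m≤m+n; <⇒<ᵇ; +-commutativeSemigroup)
open import Data.Product using (proj₁; proj₂)
open import Data.Vec using (Vec; []; _∷_; lookup; tabulate; zipWith; tail)
open import Data.Vec.Properties
  using (∷-injective; lookup∘tabulate; lookup-zipWith; lookup-replicate; []=⇒lookup; lookup⇒[]=)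
open import Data.Vec.Relation.Binary.Pointwise.Extensional using (ext; Pointwise-≡⇒≡)
open import Function using (_∘_; id; Equivalence; mk⇔)
open import Relation.Binary.PropositionalEquality
  using (_≡_; _≢_; refl; sym; trans; cong; cong₂; subst; module ≡-Reasoning)
open import Relation.Nullary using (yes; no)

open import Algebra.Properties.CommutativeSemigroup +-commutativeSemigroup
  using () renaming (interchange to +-interchange)
open import Algebra.Properties.CommutativeSemigroup
  (CommutativeMonoid.commutativeSemigroup ∧-commutativeMonoid)
  using () renaming (interchange to ∧-interchange)

-- Sums over lists

∑ : {A : Set} → List A → (A → ℕ) → ℕ
∑ xs f = sum (map f xs)

𝟙 : Bool → ℕ
𝟙 b = if b then 1 else 0

module _ {A : Set} where

  ∑-cong : (xs : List A) {f g : A → ℕ} → (∀ a → f a ≡ g a) → ∑ xs f ≡ ∑ xs g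
  ∑-cong xs f≗g = cong sum (map-cong f≗g xs)

  ∑-zero : (xs : List A) → ∑ xs (λ _ → 0) ≡ 0
  ∑-zero []       = refl
  ∑-zero (_ ∷ xs) = ∑-zero xs

  ∑-+ : (xs : List A) (f g : A → ℕ) → ∑ xs (λ a → f a + g a) ≡ ∑ xs f + ∑ xs g
  ∑-+ []       f g = refl
  ∑-+ (x ∷ xs) f g =
    trans (cong (f x + g x +_) (∑-+ xs f g)) (+-interchange (f x) (g x) (∑ xs f) (∑ xs g))

  ∑-*ˡ : (xs : List A) (n : ℕ) (f : A → ℕ) → ∑ xs (λ a → n * f a) ≡ n * ∑ xs f
  ∑-*ˡ []       n f = sym (*-zeroʳ n)
  ∑-*ˡ (x ∷ xs) n f = trans (cong (n * f x +_) (∑-*ˡ xs n f)) (sym (*-distribˡ-+ n (f x) (∑ xs f)))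

  ∑-*ʳ : (xs : List A) (n : ℕ) (f : A → ℕ) → ∑ xs (λ a → f a * n) ≡ ∑ xs f * n
  ∑-*ʳ []       n f = refl
  ∑-*ʳ (x ∷ xs) n f = trans (cong (f x * n +_) (∑-*ʳ xs n f)) (sym (*-distribʳ-+ n (f x) (∑ xs f)))

  ∑-++ : (xs ys : List A) (f : A → ℕ) → ∑ (xs ++ ys) f ≡ ∑ xs f + ∑ ys f
  ∑-++ xs ys f = trans (cong sum (map-++ f xs ys)) (sum-++ (map f xs) (map f ys))

  count≡∑𝟙 : (p : A → Bool) (xs : List A) → count p xs ≡ ∑ xs (λ a → 𝟙 (p a))
  count≡∑𝟙 p []       = refl
  count≡∑𝟙 p (x ∷ xs) with p x
  ... | true  = cong suc (count≡∑𝟙 p xs)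
  ... | false = count≡∑𝟙 p xs

module _ {A B : Set} where

  ∑-map : (g : A → B) (xs : List A) (f : B → ℕ) → ∑ (map g xs) f ≡ ∑ xs (λ a → f (g a))
  ∑-map g xs f = cong sum (sym (map-∘ xs))

  ∑-concatMap : (g : A → List B) (xs : List A) (f : B → ℕ) →
                ∑ (concatMap g xs) f ≡ ∑ xs (λ a → ∑ (g a) f)
  ∑-concatMap g []       f = refl
  ∑-concatMap g (x ∷ xs) f =
    trans (∑-++ (g x) (concatMap g xs) f) (cong (∑ (g x) f +_) (∑-concatMap g xs f))

  ∑-comm : (xs : List A) (ys : List B) (h : A → B → ℕ) →
           ∑ xs (λ a → ∑ ys (λ b → h a b)) ≡ ∑ ys (λ b → ∑ xs (λ a → h a b))
  ∑-comm []       ys h = sym (∑-zero ys)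
  ∑-comm (x ∷ xs) ys h =
    trans (cong (∑ ys (h x) +_) (∑-comm xs ys h)) (sym (∑-+ ys (h x) (λ b → ∑ xs (λ a → h a b))))

  ∑*∑ : (xs : List A) (ys : List B) (f : A → ℕ) (g : B → ℕ) →
        ∑ xs f * ∑ ys g ≡ ∑ xs (λ a → ∑ ys (λ b → f a * g b))
  ∑*∑ xs ys f g = sym (trans (∑-cong xs (λ a → ∑-*ˡ ys (f a) g)) (∑-*ʳ xs (∑ ys g) f))

  ∑∑-if : (b : Bool) (xs : List A) (ys : List B) (h : A → B → ℕ) →
          (if b then ∑ xs (λ a → ∑ ys (h a)) else 0) ≡ ∑ xs (λ a → ∑ ys (λ y → if b then h a y else 0))
  ∑∑-if true  xs ys h = refl
  ∑∑-if false xs ys h = sym (trans (∑-cong xs (λ a → ∑-zero ys)) (∑-zero xs))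

if-𝟙 : (a b : Bool) → (if a then 𝟙 b else 0) ≡ 𝟙 (a ∧ b)
if-𝟙 true  b = refl
if-𝟙 false b = refl

𝟙-∧ : (a b : Bool) → 𝟙 a * 𝟙 b ≡ 𝟙 (a ∧ b)
𝟙-∧ false b = refl
𝟙-∧ true  b = +-identityʳ (𝟙 b)

if-∧ : (p q : Bool) (n : ℕ) → (if p then (if q then n else 0) else 0) ≡ (if q ∧ p then n else 0)
if-∧ true  true  n = refl
if-∧ true  false n = refl
if-∧ false true  n = refl
if-∧ false false n = refl

∧-elimˡ : ∀ {a b} → a ∧ b ≡ true → a ≡ true
∧-elimˡ {true} _ = refl

∧-elimʳ : ∀ {a b} → a ∧ b ≡ true → b ≡ true
∧-elimʳ {true} b≡true = b≡true

∧-absorb : ∀ l a i → (a ≡ true → i ≡ true) → l ∧ a ≡ i ∧ ((l ∧ i) ∧ a)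
∧-absorb false a     false _ = refl
∧-absorb false a     true  _ = refl
∧-absorb true  false false _ = refl
∧-absorb true  false true  _ = refl
∧-absorb true  true  i     a⇒i rewrite a⇒i refl = refl

∧-rearrange : ∀ w l a i p → (w ≡ true → p ≡ a) → (a ≡ true → i ≡ true) →
              w ∧ (l ∧ a) ≡ i ∧ ((l ∧ i) ∧ (w ∧ p))
∧-rearrange false l     a false p _   _   = refl
∧-rearrange false false a true  p _   _   = refl
∧-rearrange false true  a true  p _   _   = refl
∧-rearrange true  l     a i     p w⇒p a⇒i rewrite w⇒p refl = ∧-absorb l a i a⇒i

==⇒≡ : ∀ a b → (a == b) ≡ true → a ≡ b
==⇒≡ true  true  _ = refl
==⇒≡ false false _ = refl

==-refl : ∀ a → (a == a) ≡ true
==-refl true  = refl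
==-refl false = refl

<ᵇ-true : {m n : ℕ} → m < n → (m <ᵇ n) ≡ true
<ᵇ-true m<n = Equivalence.to T-≡ (<⇒<ᵇ m<n)

<ᵇ-false : {m n : ℕ} → n ≤ m → (m <ᵇ n) ≡ false
<ᵇ-false {n = zero}      z≤n       = refl
<ᵇ-false {suc m} {suc n} (s≤s n≤m) = <ᵇ-false n≤m

<ᵇ-suc : ∀ m n → (m <ᵇ n) ≡ true → (m <ᵇ suc n) ≡ true
<ᵇ-suc zero    n       _ = refl
<ᵇ-suc (suc m) (suc n) h = <ᵇ-suc m n h

+-<ᵇ : ∀ a m n → ((a + m) <ᵇ (a + n)) ≡ (m <ᵇ n)
+-<ᵇ zero    m n = refl
+-<ᵇ (suc a) m n = +-<ᵇ a m n

module _ {A : Set} where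

  allB-++ : (p : A → Bool) (xs ys : List A) → allB p (xs ++ ys) ≡ allB p xs ∧ allB p ys
  allB-++ p []       ys = refl
  allB-++ p (x ∷ xs) ys = trans (cong (p x ∧_) (allB-++ p xs ys)) (sym (∧-assoc (p x) _ _))

  allB-cong : {p q : A → Bool} (xs : List A) → (∀ {a} → a ∈ xs → p a ≡ q a) → allB p xs ≡ allB q xs
  allB-cong []       p≗q = refl
  allB-cong (x ∷ xs) p≗q = cong₂ _∧_ (p≗q (here refl)) (allB-cong xs (p≗q ∘ there))

  allB-∧ : (p q : A → Bool) (xs : List A) → allB (λ a → p a ∧ q a) xs ≡ allB p xs ∧ allB q xs
  allB-∧ p q []       = refl
  allB-∧ p q (x ∷ xs) = trans (cong ((p x ∧ q x) ∧_) (allB-∧ p q xs)) (∧-interchange (p x) (q x) _ _)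

  allB⁺ : {p : A → Bool} (xs : List A) → (∀ a → p a ≡ true) → allB p xs ≡ true
  allB⁺     []       p≡true = refl
  allB⁺ {p} (x ∷ xs) p≡true = trans (cong (_∧ allB p xs) (p≡true x)) (allB⁺ xs p≡true)

  allB⁻ : {p : A → Bool} (xs : List A) → allB p xs ≡ true → ∀ {a} → a ∈ xs → p a ≡ true
  allB⁻ {p} (x ∷ xs) all≡true (here refl) with p x
  ... | true = refl
  allB⁻ {p} (x ∷ xs) all≡true (there a∈xs) with p x
  ... | true = allB⁻ xs all≡true a∈xs

allB-map : {A B : Set} (p : B → Bool) (f : A → B) (xs : List A) → allB p (map f xs) ≡ allB (p ∘ f) xs
allB-map p f []       = refl
allB-map p f (x ∷ xs) = cong (p (f x) ∧_) (allB-map p f xs)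

applyUpTo-+ : {A : Set} (f : ℕ → A) (m n : ℕ) →
              applyUpTo f (m + n) ≡ applyUpTo f m ++ applyUpTo (f ∘ (m +_)) n
applyUpTo-+ f zero    n = refl
applyUpTo-+ f (suc m) n = cong (f 0 ∷_) (applyUpTo-+ (f ∘ suc) m n)

-- Enumerations

allFin-suc : (n : ℕ) → allFin (suc n) ≡ zero ∷ map suc (allFin n)
allFin-suc n = cong (zero ∷_) (sym (map-tabulate id suc))

∑-allFin-suc : (n : ℕ) (f : Fin (suc n) → ℕ) → ∑ (allFin (suc n)) f ≡ f zero + ∑ (allFin n) (f ∘ suc)
∑-allFin-suc n f = trans (cong (λ is → ∑ is f) (allFin-suc n)) (cong (f zero +_) (∑-map suc (allFin n) f))

∑-allFin-+ : (m n : ℕ) (f : Fin (m + n) → ℕ) →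
             ∑ (allFin (m + n)) f ≡ ∑ (allFin m) (λ i → f (i ↑ˡ n)) + ∑ (allFin n) (λ j → f (m ↑ʳ j))
∑-allFin-+ zero    n f = refl
∑-allFin-+ (suc m) n f = begin
  ∑ (allFin (suc (m + n))) f
    ≡⟨ ∑-allFin-suc (m + n) f ⟩
  f zero + ∑ (allFin (m + n)) (f ∘ suc)
    ≡⟨ cong (f zero +_) (∑-allFin-+ m n (f ∘ suc)) ⟩
  f zero + (∑ (allFin m) (λ i → f (suc (i ↑ˡ n))) + ∑ (allFin n) (λ j → f (suc m ↑ʳ j)))
    ≡⟨ +-assoc (f zero) _ _ ⟨
  f zero + ∑ (allFin m) (λ i → f (suc (i ↑ˡ n))) + ∑ (allFin n) (λ j → f (suc m ↑ʳ j))
    ≡⟨ cong (_+ ∑ (allFin n) (λ j → f (suc m ↑ʳ j))) (∑-allFin-suc m (λ i → f (i ↑ˡ n))) ⟨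
  ∑ (allFin (suc m)) (λ i → f (i ↑ˡ n)) + ∑ (allFin n) (λ j → f (suc m ↑ʳ j))
    ∎
  where open ≡-Reasoning

∑-allVecs-suc : {A : Set} (xs : List A) (k : ℕ) (f : Vec A (suc k) → ℕ) →
                ∑ (allVecs xs (suc k)) f ≡ ∑ (allVecs xs k) (λ w → ∑ xs (λ a → f (a ∷ w)))
∑-allVecs-suc xs k f =
  trans (∑-concatMap _ (allVecs xs k) f) (∑-cong (allVecs xs k) (λ w → ∑-map (_∷ w) xs f))

∑-allSubsets-single : (k : ℕ) (T : Subset k) (g : Subset k → ℕ) → (∀ S → S ≢ T → g S ≡ 0) →
                      ∑ (allSubsets k) g ≡ g T
∑-allSubsets-single zero    []      g _   = +-identityʳ (g [])
∑-allSubsets-single (suc k) (t ∷ T) g g≡0 = begin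
  ∑ (allSubsets (suc k)) g
    ≡⟨ ∑-concatMap _ (allSubsets k) g ⟩
  ∑ (allSubsets k) (λ S → g (false ∷ S) + (g (true ∷ S) + 0))
    ≡⟨ ∑-cong (allSubsets k) (λ S → cong (g (false ∷ S) +_) (+-identityʳ (g (true ∷ S)))) ⟩
  ∑ (allSubsets k) (λ S → g (false ∷ S) + g (true ∷ S))
    ≡⟨ ∑-+ (allSubsets k) _ _ ⟩
  ∑ (allSubsets k) (λ S → g (false ∷ S)) + ∑ (allSubsets k) (λ S → g (true ∷ S))
    ≡⟨ cong₂ _+_ (onHead false) (onHead true) ⟩
  g (false ∷ T) + g (true ∷ T)
    ≡⟨ single t g≡0 ⟩
  g (t ∷ T)
    ∎
  where
  open ≡-Reasoning
  onHead : ∀ b → ∑ (allSubsets k) (λ S → g (b ∷ S)) ≡ g (b ∷ T)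
  onHead b = ∑-allSubsets-single k T (λ S → g (b ∷ S))
                                  (λ S S≢T → g≡0 (b ∷ S) (S≢T ∘ proj₂ ∘ ∷-injective))
  single : ∀ t → (∀ S → S ≢ t ∷ T → g S ≡ 0) → g (false ∷ T) + g (true ∷ T) ≡ g (t ∷ T)
  single false g≡0 = trans (cong (g (false ∷ T) +_) (g≡0 (true ∷ T) λ ())) (+-identityʳ _)
  single true  g≡0 = cong (_+ g (true ∷ T)) (g≡0 (false ∷ T) λ ())

-- Gluing colorings

Coloring : ℕ → ℕ → Set
Coloring k n = Vec (Maybe (Fin n)) k

allColorings : (n k : ℕ) → List (Coloring k n)
allColorings n = allVecs (allMaybeFin n)

module _ {x y : ℕ} where

  glueColor : Maybe (Fin x) → Maybe (Fin y) → Maybe (Fin (x + y))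
  glueColor (just a) _        = just (a ↑ˡ y)
  glueColor nothing  (just b) = just (x ↑ʳ b)
  glueColor nothing  nothing  = nothing

  compatibleColor : Maybe (Fin x) → Maybe (Fin y) → Bool
  compatibleColor (just _) (just _) = false
  compatibleColor _        _        = true

  glue : {k : ℕ} → Coloring k x → Coloring k y → Coloring k (x + y)
  glue = zipWith glueColor

  compatible : {k : ℕ} → Coloring k x → Coloring k y → Bool
  compatible u v = allB (λ i → compatibleColor (lookup u i) (lookup v i)) (allFin _)

  compatible-∷ : {k : ℕ} (a : Maybe (Fin x)) (b : Maybe (Fin y)) (u : Coloring k x) (v : Coloring k y) →
                 compatible (a ∷ u) (b ∷ v) ≡ compatibleColor a b ∧ compatible u v
  compatible-∷ {k} a b u v =
    trans (cong (allB _) (allFin-suc k)) (cong (compatibleColor a b ∧_) (allB-map _ suc (allFin k)))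

  ∑-allMaybeFin-+ : (h : Maybe (Fin (x + y)) → ℕ) →
    ∑ (allMaybeFin (x + y)) h ≡
    ∑ (allMaybeFin x) (λ a → ∑ (allMaybeFin y) (λ b → if compatibleColor a b then h (glueColor a b) else 0))
  ∑-allMaybeFin-+ h = begin
    h nothing + ∑ (map just (allFin (x + y))) h
      ≡⟨ cong (h nothing +_) (trans (∑-map just (allFin (x + y)) h) (∑-allFin-+ x y (h ∘ just))) ⟩
    h nothing + (∑ (allFin x) lo + ∑ (allFin y) hi)
      ≡⟨ cong (h nothing +_) (+-comm (∑ (allFin x) lo) _) ⟩
    h nothing + (∑ (allFin y) hi + ∑ (allFin x) lo)
      ≡⟨ +-assoc (h nothing) _ _ ⟨
    h nothing + ∑ (allFin y) hi + ∑ (allFin x) lo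
      ≡⟨ cong₂ _+_ (cong (h nothing +_) (sym (∑-map just (allFin y) _)))
                   (trans (∑-cong (allFin x) onlyNothing) (sym (∑-map just (allFin x) pairedWith))) ⟩
    ∑ (allMaybeFin x) pairedWith
      ∎
    where
    open ≡-Reasoning
    lo : Fin x → ℕ
    lo i = h (just (i ↑ˡ y))
    hi : Fin y → ℕ
    hi j = h (just (x ↑ʳ j))
    pairedWith : Maybe (Fin x) → ℕ
    pairedWith a = ∑ (allMaybeFin y) (λ b → if compatibleColor a b then h (glueColor a b) else 0)
    onlyNothing : ∀ i → lo i ≡ pairedWith (just i)
    onlyNothing i = sym (trans (cong (lo i +_) (trans (∑-map just (allFin y) _) (∑-zero (allFin y))))
                               (+-identityʳ (lo i)))

  ∑-allColorings-+ : (k : ℕ) (g : Coloring k (x + y) → ℕ) →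
    ∑ (allColorings (x + y) k) g ≡
    ∑ (allColorings x k) (λ u → ∑ (allColorings y k) (λ v → if compatible u v then g (glue u v) else 0))
  ∑-allColorings-+ zero    g = sym (+-identityʳ _)
  ∑-allColorings-+ (suc k) g = begin
    ∑ (allColorings (x + y) (suc k)) g
      ≡⟨ ∑-allVecs-suc _ k g ⟩
    ∑ (allColorings (x + y) k) (λ w → ∑ (allMaybeFin (x + y)) (λ c → g (c ∷ w)))
      ≡⟨ ∑-allColorings-+ k _ ⟩
    ∑ Uk (λ u → ∑ Vk (λ v → if compatible u v then ∑ (allMaybeFin (x + y)) (λ c → g (c ∷ glue u v)) else 0))
      ≡⟨ ∑-cong Uk (λ u → ∑-cong Vk (λ v →
           cong (if compatible u v then_else 0) (∑-allMaybeFin-+ (λ c → g (c ∷ glue u v))))) ⟩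
    ∑ Uk (λ u → ∑ Vk (λ v → if compatible u v then ∑ Mx (λ a → ∑ My (λ b → G a b u v)) else 0))
      ≡⟨ ∑-cong Uk (λ u → ∑-cong Vk (λ v → ∑∑-if (compatible u v) Mx My _)) ⟩
    ∑ Uk (λ u → ∑ Vk (λ v → ∑ Mx (λ a → ∑ My (λ b → H a b u v))))
      ≡⟨ ∑-cong Uk (λ u → ∑-comm Vk Mx _) ⟩
    ∑ Uk (λ u → ∑ Mx (λ a → ∑ Vk (λ v → ∑ My (λ b → H a b u v))))
      ≡⟨ ∑-allVecs-suc Mx k _ ⟨
    ∑ (allColorings x (suc k)) (λ u → ∑ Vk (λ v → ∑ My (λ b → H (lookup u zero) b (tail u) v)))
      ≡⟨ ∑-cong (allColorings x (suc k)) (λ u → sym (∑-allVecs-suc My k _)) ⟩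
    ∑ (allColorings x (suc k)) (λ u → ∑ (allColorings y (suc k)) (λ v →
      H (lookup u zero) (lookup v zero) (tail u) (tail v)))
      ≡⟨ ∑-cong (allColorings x (suc k)) (λ u → ∑-cong (allColorings y (suc k)) (λ v → H-∷ u v)) ⟩
    ∑ (allColorings x (suc k)) (λ u → ∑ (allColorings y (suc k)) (λ v →
      if compatible u v then g (glue u v) else 0))
      ∎
    where
    open ≡-Reasoning
    Uk = allColorings x k
    Vk = allColorings y k
    Mx = allMaybeFin x
    My = allMaybeFin y
    G : Maybe (Fin x) → Maybe (Fin y) → Coloring k x → Coloring k y → ℕ
    G a b u v = if compatibleColor a b then g (glueColor a b ∷ glue u v) else 0
    H : Maybe (Fin x) → Maybe (Fin y) → Coloring k x → Coloring k y → ℕ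
    H a b u v = if compatible u v then G a b u v else 0
    H-∷ : ∀ (u : Coloring (suc k) x) (v : Coloring (suc k) y) →
          H (lookup u zero) (lookup v zero) (tail u) (tail v) ≡ (if compatible u v then g (glue u v) else 0)
    H-∷ (a ∷ u) (b ∷ v) =
      trans (if-∧ (compatible u v) (compatibleColor a b) _)
            (cong (if_then g (glueColor a b ∷ glue u v) else 0) (sym (compatible-∷ a b u v)))

-- Levels of colorings

module _ {n : ℕ} where

  below-zero : (a : Maybe (Fin n)) → below 0 a ≡ false
  below-zero nothing  = refl
  below-zero (just _) = refl

  below-≥ : {m : ℕ} → n ≤ m → (a : Maybe (Fin n)) → below m a ≡ is-just a
  below-≥ n≤m nothing  = refl
  below-≥ n≤m (just a) = <ᵇ-true (≤-trans (toℕ<n a) n≤m)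

  below⇒is-just : (m : ℕ) (a : Maybe (Fin n)) → below m a ≡ true → is-just a ≡ true
  below⇒is-just m (just _) _ = refl

  below-suc : (m : ℕ) (a : Maybe (Fin n)) → below m a ≡ true → below (suc m) a ≡ true
  below-suc m (just a) = <ᵇ-suc (toℕ a) m

module _ {x y : ℕ} where

  below-glue-≤ : {m : ℕ} → m ≤ x → (a : Maybe (Fin x)) (b : Maybe (Fin y)) →
                 below m (glueColor a b) ≡ below m a
  below-glue-≤ {m} m≤x (just a) b        = cong (_<ᵇ m) (toℕ-↑ˡ a y)
  below-glue-≤ {m} m≤x nothing  (just b) =
    trans (cong (_<ᵇ m) (toℕ-↑ʳ x b)) (<ᵇ-false (≤-trans m≤x (m≤m+n x (toℕ b))))
  below-glue-≤     m≤x nothing  nothing  = refl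

  below-glue-+ : (j : ℕ) (a : Maybe (Fin x)) (b : Maybe (Fin y)) →
                 below (x + j) (glueColor a b) ≡ below j b ∨ is-just a
  below-glue-+ j (just a) b        =
    trans (cong (_<ᵇ x + j) (toℕ-↑ˡ a y))
          (trans (<ᵇ-true (≤-trans (toℕ<n a) (m≤m+n x j))) (sym (∨-zeroʳ _)))
  below-glue-+ j nothing  (just b) =
    trans (cong (_<ᵇ x + j) (toℕ-↑ʳ x b)) (trans (+-<ᵇ x (toℕ b) j) (sym (∨-identityʳ _)))
  below-glue-+ j nothing  nothing  = refl

  compatibleColor∧is-just-glue : (a : Maybe (Fin x)) (b : Maybe (Fin y)) →
    compatibleColor a b ∧ (is-just (glueColor a b) == true) ≡ (is-just b == not (is-just a))
  compatibleColor∧is-just-glue (just _) (just _) = refl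
  compatibleColor∧is-just-glue (just _) nothing  = refl
  compatibleColor∧is-just-glue nothing  (just _) = refl
  compatibleColor∧is-just-glue nothing  nothing  = refl

supp : {k n : ℕ} → Coloring k n → Subset k
supp f = tabulate (is-just ∘ lookup f)

lookup-─ : {k : ℕ} (X Y : Subset k) (i : Fin k) → lookup (X ─ Y) i ≡ lookup X i ∧ not (lookup Y i)
lookup-─ (a ∷ X) (true  ∷ Y) zero    = sym (∧-zeroʳ a)
lookup-─ (a ∷ X) (false ∷ Y) zero    = sym (∧-identityʳ a)
lookup-─ (_ ∷ X) (_     ∷ Y) (suc i) = lookup-─ X Y i

⊆ᵇ-true : {k : ℕ} (X Y : Subset k) → (∀ i → lookup X i ≡ true → lookup Y i ≡ true) →
          (X ⊆ᵇ Y) ≡ true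
⊆ᵇ-true X Y X⊆Y with X ⊆? Y
... | yes _   = refl
... | no  X⊈Y = ⊥-elim (X⊈Y (λ {i} i∈X → lookup⇒[]= i Y (X⊆Y i ([]=⇒lookup i∈X))))

module _ {k n : ℕ} (f : Coloring k n) where

  lookup-preimage : (m : ℕ) (i : Fin k) → lookup (preimage f m) i ≡ below m (lookup f i)
  lookup-preimage m = lookup∘tabulate _

  lookup-supp : (i : Fin k) → lookup (supp f) i ≡ is-just (lookup f i)
  lookup-supp = lookup∘tabulate _

  preimage-zero : preimage f 0 ≡ ⊥
  preimage-zero = Pointwise-≡⇒≡ (ext λ i →
    trans (lookup-preimage 0 i) (trans (below-zero (lookup f i)) (sym (lookup-replicate i false))))

  preimage-≥ : {m : ℕ} → n ≤ m → preimage f m ≡ supp f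
  preimage-≥ {m} n≤m = Pointwise-≡⇒≡ (ext λ i →
    trans (lookup-preimage m i) (trans (below-≥ n≤m (lookup f i)) (sym (lookup-supp i))))

  preimage-⊆ᵇ-supp : (m : ℕ) → (preimage f m ⊆ᵇ supp f) ≡ true
  preimage-⊆ᵇ-supp m = ⊆ᵇ-true _ _ λ i i∈f⁻¹m →
    trans (lookup-supp i) (below⇒is-just m (lookup f i) (trans (sym (lookup-preimage m i)) i∈f⁻¹m))

  preimage-⊆ᵇ-suc : (m : ℕ) → (preimage f m ⊆ᵇ preimage f (suc m)) ≡ true
  preimage-⊆ᵇ-suc m = ⊆ᵇ-true _ _ λ i i∈f⁻¹m →
    trans (lookup-preimage (suc m) i) (below-suc m (lookup f i) (trans (sym (lookup-preimage m i)) i∈f⁻¹m))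

  validOn-supp : validOn (supp f) f ≡ true
  validOn-supp = allB⁺ (allFin k) λ i →
    trans (cong (is-just (lookup f i) ==_) (lookup-supp i)) (==-refl (is-just (lookup f i)))

  validOn⇒supp≡ : (N : Subset k) → validOn N f ≡ true → supp f ≡ N
  validOn⇒supp≡ N valid = Pointwise-≡⇒≡ (ext λ i →
    trans (lookup-supp i) (==⇒≡ _ _ (allB⁻ (allFin k) valid (∈-allFin i))))

module _ {k x y : ℕ} (u : Coloring k x) (v : Coloring k y) where

  lookup-glue : (i : Fin k) → lookup (glue u v) i ≡ glueColor (lookup u i) (lookup v i)
  lookup-glue i = lookup-zipWith glueColor i u v

  preimage-glue-≤ : {m : ℕ} → m ≤ x → preimage (glue u v) m ≡ preimage u m
  preimage-glue-≤ {m} m≤x = Pointwise-≡⇒≡ (ext λ i → begin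
    lookup (preimage (glue u v) m) i              ≡⟨ lookup-preimage (glue u v) m i ⟩
    below m (lookup (glue u v) i)                 ≡⟨ cong (below m) (lookup-glue i) ⟩
    below m (glueColor (lookup u i) (lookup v i)) ≡⟨ below-glue-≤ m≤x (lookup u i) (lookup v i) ⟩
    below m (lookup u i)                          ≡⟨ lookup-preimage u m i ⟨
    lookup (preimage u m) i                       ∎)
    where open ≡-Reasoning

  preimage-glue-+ : (j : ℕ) → preimage (glue u v) (x + j) ≡ preimage v j ∪ supp u
  preimage-glue-+ j = Pointwise-≡⇒≡ (ext λ i → begin
    lookup (preimage (glue u v) (x + j)) i              ≡⟨ lookup-preimage (glue u v) (x + j) i ⟩
    below (x + j) (lookup (glue u v) i)                 ≡⟨ cong (below (x + j)) (lookup-glue i) ⟩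
    below (x + j) (glueColor (lookup u i) (lookup v i)) ≡⟨ below-glue-+ j (lookup u i) (lookup v i) ⟩
    below j (lookup v i) ∨ is-just (lookup u i)         ≡⟨ cong₂ _∨_ (lookup-preimage v j i) (lookup-supp u i) ⟨
    lookup (preimage v j) i ∨ lookup (supp u) i         ≡⟨ lookup-zipWith _∨_ i (preimage v j) (supp u) ⟨
    lookup (preimage v j ∪ supp u) i                    ∎)
    where open ≡-Reasoning

  compatible∧validOn-glue : (N : Subset k) → (∀ i → lookup N i ≡ true) →
    compatible u v ∧ validOn N (glue u v) ≡ validOn (N ─ supp u) v
  compatible∧validOn-glue N N≡⊤ =
    trans (sym (allB-∧ _ _ (allFin k))) (allB-cong (allFin k) (λ {i} _ → pointwise i))
    where
    pointwise : ∀ i → compatibleColor (lookup u i) (lookup v i) ∧ (is-just (lookup (glue u v) i) == lookup N i)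
                      ≡ (is-just (lookup v i) == lookup (N ─ supp u) i)
    pointwise i = begin
      compatibleColor (lookup u i) (lookup v i) ∧ (is-just (lookup (glue u v) i) == lookup N i)
        ≡⟨ cong₂ (λ c n → compatibleColor (lookup u i) (lookup v i) ∧ (is-just c == n))
                 (lookup-glue i) (N≡⊤ i) ⟩
      compatibleColor (lookup u i) (lookup v i) ∧ (is-just (glueColor (lookup u i) (lookup v i)) == true)
        ≡⟨ compatibleColor∧is-just-glue (lookup u i) (lookup v i) ⟩
      is-just (lookup v i) == not (is-just (lookup u i))
        ≡⟨ cong (is-just (lookup v i) ==_)
             (trans (lookup-─ N (supp u) i) (cong₂ (λ n s → n ∧ not s) (N≡⊤ i) (lookup-supp u i))) ⟨
      is-just (lookup v i) == lookup (N ─ supp u) i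
        ∎
      where open ≡-Reasoning

-- Properness of glued colorings

properColoring : {k n : ℕ} → Problem k → Coloring k n → Bool
properColoring c f = validOn (ground c) f ∧ proper c f

decomposes : {k x y : ℕ} → Problem k → Subset k → Coloring k x → Coloring k y → Bool
decomposes c S u v = inP c S ∧ (properColoring (restrict c S) u ∧ properColoring (contract c S) v)

decomposes⇒≡supp : {k x y : ℕ} (c : Problem k) (S : Subset k) (u : Coloring k x) (v : Coloring k y) →
                   decomposes c S u v ≡ true → S ≡ supp u
decomposes⇒≡supp c S u v dec =
  sym (validOn⇒supp≡ u S (∧-elimˡ {b = proper (restrict c S) u} (∧-elimˡ (∧-elimʳ {inP c S} dec))))

module _ {k : ℕ} (c : Problem k) where

  step : {n : ℕ} → Coloring k n → ℕ → Bool
  step f m = inI c (preimage f m) (preimage f (suc m))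

  -- the condition proper (contract c S) v without its two inclusions, which hold for valid v
  stepsAbove : {y : ℕ} → Subset k → Coloring k y → Bool
  stepsAbove {y} S v = allB (λ j → inI c (preimage v j ∪ S) (preimage v (suc j) ∪ S)) (upTo (suc y))

  proper-restrict-supp : {n : ℕ} (u : Coloring k n) → proper (restrict c (supp u)) u ≡ proper c u
  proper-restrict-supp {n} u = allB-cong (upTo (suc n)) λ {m} _ →
    trans (cong (step u m ∧_) (preimage-⊆ᵇ-supp u (suc m))) (∧-identityʳ (step u m))

  proper-∷ʳ : {x : ℕ} (u : Coloring k x) → proper c u ≡ allB (step u) (upTo x) ∧ inI c (supp u) (supp u)
  proper-∷ʳ {x} u = begin
    allB (step u) (upTo (suc x))                 ≡⟨ cong (allB (step u)) (upTo-∷ʳ x) ⟨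
    allB (step u) (upTo x ++ [ x ])              ≡⟨ allB-++ (step u) (upTo x) [ x ] ⟩
    allB (step u) (upTo x) ∧ (step u x ∧ true)   ≡⟨ cong (allB (step u) (upTo x) ∧_) lastStep ⟩
    allB (step u) (upTo x) ∧ inI c (supp u) (supp u) ∎
    where
    open ≡-Reasoning
    lastStep : step u x ∧ true ≡ inI c (supp u) (supp u)
    lastStep = trans (∧-identityʳ (step u x)) (cong₂ (inI c) (preimage-≥ u ≤-refl) (preimage-≥ u (n≤1+n x)))

  proper-contract : {y : ℕ} (S : Subset k) (v : Coloring k y) → validOn (ground c ─ S) v ≡ true →
                    proper (contract c S) v ≡ stepsAbove S v
  proper-contract {y} S v valid = allB-cong (upTo (suc y)) λ {j} _ →
    cong₂ (λ a b → a ∧ (b ∧ inI c (preimage v j ∪ S) (preimage v (suc j) ∪ S)))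
          (preimage-⊆ᵇ-suc v j)
          (subst (λ N → (preimage v (suc j) ⊆ᵇ N) ≡ true) (validOn⇒supp≡ v _ valid)
                 (preimage-⊆ᵇ-supp v (suc j)))

  proper-glue : {x y : ℕ} (u : Coloring k x) (v : Coloring k y) →
                proper c (glue u v) ≡ allB (step u) (upTo x) ∧ stepsAbove (supp u) v
  proper-glue {x} {y} u v = begin
    allB (step (glue u v)) (upTo (suc (x + y)))
      ≡⟨ cong (λ n → allB (step (glue u v)) (upTo n)) (+-suc x y) ⟨
    allB (step (glue u v)) (upTo (x + suc y))
      ≡⟨ cong (allB (step (glue u v))) (applyUpTo-+ id x (suc y)) ⟩
    allB (step (glue u v)) (upTo x ++ applyUpTo (x +_) (suc y))
      ≡⟨ allB-++ (step (glue u v)) (upTo x) _ ⟩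
    allB (step (glue u v)) (upTo x) ∧ allB (step (glue u v)) (applyUpTo (x +_) (suc y))
      ≡⟨ cong₂ _∧_ lower upper ⟩
    allB (step u) (upTo x) ∧ stepsAbove (supp u) v
      ∎
    where
    open ≡-Reasoning
    lower : allB (step (glue u v)) (upTo x) ≡ allB (step u) (upTo x)
    lower = allB-cong (upTo x) λ m∈ →
      cong₂ (inI c) (preimage-glue-≤ u v (<⇒≤ (∈-upTo⁻ m∈))) (preimage-glue-≤ u v (∈-upTo⁻ m∈))
    shifted : ∀ j → step (glue u v) (x + j) ≡ inI c (preimage v j ∪ supp u) (preimage v (suc j) ∪ supp u)
    shifted j = cong₂ (inI c) (preimage-glue-+ u v j)
                      (trans (cong (preimage (glue u v)) (sym (+-suc x j))) (preimage-glue-+ u v (suc j)))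
    upper : allB (step (glue u v)) (applyUpTo (x +_) (suc y)) ≡ stepsAbove (supp u) v
    upper = begin
      allB (step (glue u v)) (applyUpTo (x +_) (suc y))     ≡⟨ cong (allB _) (map-upTo (x +_) (suc y)) ⟨
      allB (step (glue u v)) (map (x +_) (upTo (suc y)))    ≡⟨ allB-map (step (glue u v)) (x +_) (upTo (suc y)) ⟩
      allB (λ j → step (glue u v) (x + j)) (upTo (suc y))   ≡⟨ allB-cong (upTo (suc y)) (λ {j} _ → shifted j) ⟩
      stepsAbove (supp u) v                                ∎

  module _ (isC : IsColoringProblem c) where
    open IsColoringProblem isC

    inI-refl≡inP : (S : Subset k) → inI c S S ≡ inP c S
    inI-refl≡inP S = ⇔→≡ {z = true} (mk⇔ (proj₁ ∘ I-interval S S) (I-diag S))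

    stepsAbove⇒inP : {y : ℕ} (S : Subset k) (v : Coloring k y) → stepsAbove S v ≡ true → inP c S ≡ true
    stepsAbove⇒inP S v steps = subst (λ T → inP c T ≡ true) bottom≡S (proj₁ (I-interval _ _ (∧-elimˡ steps)))
      where
      bottom≡S : preimage v 0 ∪ S ≡ S
      bottom≡S = trans (cong (_∪ S) (preimage-zero v)) (∪-identityˡ S)

    compatible∧properColoring-glue : {x y : ℕ} → (∀ i → lookup (ground c) i ≡ true) →
      (u : Coloring k x) (v : Coloring k y) →
      compatible u v ∧ properColoring c (glue u v) ≡ decomposes c (supp u) u v
    compatible∧properColoring-glue {x} N≡⊤ u v = begin
      compatible u v ∧ (validOn (ground c) (glue u v) ∧ proper c (glue u v))
        ≡⟨ ∧-assoc (compatible u v) _ _ ⟨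
      (compatible u v ∧ validOn (ground c) (glue u v)) ∧ proper c (glue u v)
        ≡⟨ cong₂ _∧_ (compatible∧validOn-glue u v (ground c) N≡⊤) (proper-glue u v) ⟩
      validOn (ground c ─ S) v ∧ (allB (step u) (upTo x) ∧ stepsAbove S v)
        ≡⟨ ∧-rearrange _ (allB (step u) (upTo x)) _ _ _ (proper-contract S v) (stepsAbove⇒inP S v) ⟩
      inP c S ∧ ((allB (step u) (upTo x) ∧ inP c S) ∧ properColoring (contract c S) v)
        ≡⟨ cong (λ r → inP c S ∧ (r ∧ properColoring (contract c S) v)) restricted ⟨
      decomposes c S u v
        ∎
      where
      open ≡-Reasoning
      S : Subset k
      S = supp u
      restricted : properColoring (restrict c S) u ≡ allB (step u) (upTo x) ∧ inP c S
      restricted = begin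
        validOn S u ∧ proper (restrict c S) u   ≡⟨ cong₂ _∧_ (validOn-supp u) (proper-restrict-supp u) ⟩
        proper c u                              ≡⟨ proper-∷ʳ u ⟩
        allB (step u) (upTo x) ∧ inI c S S      ≡⟨ cong (allB (step u) (upTo x) ∧_) (inI-refl≡inP S) ⟩
        allB (step u) (upTo x) ∧ inP c S        ∎

module _ {k : ℕ} (c : Problem k) (x y : ℕ) where

  sumOverP-restrict*contract :
    sumOverP c (λ S → chromatic (restrict c S) x * chromatic (contract c S) y)
    ≡ ∑ (allColorings x k) (λ u → ∑ (allColorings y k) (λ v → 𝟙 (decomposes c (supp u) u v)))
  sumOverP-restrict*contract = begin
    ∑ (allSubsets k) (λ S → if inP c S then chromatic (restrict c S) x * chromatic (contract c S) y else 0)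
      ≡⟨ ∑-cong (allSubsets k) perSubset ⟩
    ∑ (allSubsets k) (λ S → ∑ U (λ u → ∑ V (λ v → 𝟙 (decomposes c S u v))))
      ≡⟨ ∑-comm (allSubsets k) U _ ⟩
    ∑ U (λ u → ∑ (allSubsets k) (λ S → ∑ V (λ v → 𝟙 (decomposes c S u v))))
      ≡⟨ ∑-cong U (λ u → ∑-comm (allSubsets k) V _) ⟩
    ∑ U (λ u → ∑ V (λ v → ∑ (allSubsets k) (λ S → 𝟙 (decomposes c S u v))))
      ≡⟨ ∑-cong U (λ u → ∑-cong V (λ v → ∑-allSubsets-single k (supp u) _ (offSupport u v))) ⟩
    ∑ U (λ u → ∑ V (λ v → 𝟙 (decomposes c (supp u) u v)))
      ∎
    where
    open ≡-Reasoning
    U = allColorings x k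
    V = allColorings y k
    perSubset : ∀ S → (if inP c S then chromatic (restrict c S) x * chromatic (contract c S) y else 0)
                      ≡ ∑ U (λ u → ∑ V (λ v → 𝟙 (decomposes c S u v)))
    perSubset S = begin
      (if inP c S then chromatic (restrict c S) x * chromatic (contract c S) y else 0)
        ≡⟨ cong (if inP c S then_else 0)
                (trans (cong₂ _*_ (count≡∑𝟙 _ U) (count≡∑𝟙 _ V)) (∑*∑ U V _ _)) ⟩
      (if inP c S then ∑ U (λ u → ∑ V (λ v → 𝟙 (restricted u) * 𝟙 (contracted v))) else 0)
        ≡⟨ ∑∑-if (inP c S) U V _ ⟩
      ∑ U (λ u → ∑ V (λ v → if inP c S then 𝟙 (restricted u) * 𝟙 (contracted v) else 0))
        ≡⟨ ∑-cong U (λ u → ∑-cong V (λ v →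
             trans (cong (if inP c S then_else 0) (𝟙-∧ (restricted u) (contracted v))) (if-𝟙 (inP c S) _))) ⟩
      ∑ U (λ u → ∑ V (λ v → 𝟙 (decomposes c S u v)))
        ∎
      where
      restricted : Coloring k x → Bool
      restricted = properColoring (restrict c S)
      contracted : Coloring k y → Bool
      contracted = properColoring (contract c S)
    offSupport : ∀ u v S → S ≢ supp u → 𝟙 (decomposes c S u v) ≡ 0
    offSupport u v S S≢supp with decomposes c S u v in dec
    ... | true  = ⊥-elim (S≢supp (decomposes⇒≡supp c S u v dec))
    ... | false = refl

  chromatic-+ : IsColoringProblem c → ground c ≡ ⊤ →
    chromatic c (x + y)
    ≡ ∑ (allColorings x k) (λ u → ∑ (allColorings y k) (λ v → 𝟙 (decomposes c (supp u) u v)))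
  chromatic-+ isC ground≡⊤ = begin
    chromatic c (x + y)
      ≡⟨ count≡∑𝟙 (properColoring c) (allColorings (x + y) k) ⟩
    ∑ (allColorings (x + y) k) (λ f → 𝟙 (properColoring c f))
      ≡⟨ ∑-allColorings-+ k _ ⟩
    ∑ U (λ u → ∑ V (λ v → if compatible u v then 𝟙 (properColoring c (glue u v)) else 0))
      ≡⟨ ∑-cong U (λ u → ∑-cong V (λ v → trans (if-𝟙 (compatible u v) (properColoring c (glue u v)))
                                               (cong 𝟙 (compatible∧properColoring-glue c isC N≡⊤ u v)))) ⟩
    ∑ U (λ u → ∑ V (λ v → 𝟙 (decomposes c (supp u) u v)))
      ∎
    where
    open ≡-Reasoning
    U = allColorings x k
    V = allColorings y k
    N≡⊤ : ∀ i → lookup (ground c) i ≡ true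
    N≡⊤ i = trans (cong (λ N → lookup N i) ground≡⊤) (lookup-replicate i true)

mainTheorem2 : (k : ℕ) (c : Problem k) → IsColoringProblem c → ground c ≡ ⊤ →
    (x y : ℕ) →
    chromatic c (x + y) ≡ sumOverP c (λ S → chromatic (restrict c S) x * chromatic (contract c S) y)
mainTheorem2 k c isC ground≡⊤ x y =
  trans (chromatic-+ c x y isC ground≡⊤) (sym (sumOverP-restrict*contract c x y))
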